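{- Let $G$ be a connected graph. If the complement $\overline{G}$ is connected and $\mathrm{diam}(\overline{G})\geq 4$, then $rc(G)\leq 4$.
   Context: All graphs are finite, undirected and simple. For an edge-coloring $c:E(H)\to\{1,\dots,k\}$ (adjacent edges may receive the same color), a path is rainbow if no two of its edges have the same color; $H$ is rainbow connected under $c$ if every two vertices are joined by a rainbow path. The rainbow connection number $rc(H)$ of a nontrivial connected graph $H$ is the minimum $k$ for which such a coloring with $k$ colors exists. $\mathrm{diam}$ denotes diameter and $\overline{G}$ the complement of $G$. -}

module Defs where

open import Data.Nat using (ℕ; zero; suc; _<_; _≤_)
open import Data.Fin using (Fin)
open import Data.Bool using (Bool; true; false; not)
open import Data.List using (List; []; _∷_; length)
open import Data.List.Relation.Unary.Unique.Propositional using (Unique)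
open import Data.Product using (Σ; _×_; ∃; ∃-syntax; _,_)
open import Relation.Binary.PropositionalEquality using (_≡_)
open import Relation.Nullary using (¬_)
import Data.Empty
import Data.Fin
import Relation.Nullary
import Relation.Binary.PropositionalEquality

record Graph (n : ℕ) : Set where
  field
    adj   : Fin n → Fin n → Bool
    sym   : ∀ u v → adj u v ≡ adj v u
    irrefl : ∀ u → adj u u ≡ false
open Graph public

complement : ∀ {n} → Graph n → Graph n
complement {n} G = record { adj = A ; sym = s ; irrefl = i }
  where
  A : Fin n → Fin n → Bool
  A u v with u Data.Fin.≟ v
  ... | Relation.Nullary.yes _ = false
  ... | Relation.Nullary.no _  = not (adj G u v)
  s : ∀ u v → A u v ≡ A v u
  s u v with u Data.Fin.≟ v | v Data.Fin.≟ u
  ... | Relation.Nullary.yes _ | Relation.Nullary.yes _ = Relation.Binary.PropositionalEquality.refl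
  ... | Relation.Nullary.yes p | Relation.Nullary.no q = Data.Empty.⊥-elim (q (Relation.Binary.PropositionalEquality.sym p))
  ... | Relation.Nullary.no p | Relation.Nullary.yes q = Data.Empty.⊥-elim (p (Relation.Binary.PropositionalEquality.sym q))
  ... | Relation.Nullary.no _ | Relation.Nullary.no _ = Relation.Binary.PropositionalEquality.cong not (sym G u v)
  i : ∀ u → A u u ≡ false
  i u with u Data.Fin.≟ u
  ... | Relation.Nullary.yes _ = Relation.Binary.PropositionalEquality.refl
  ... | Relation.Nullary.no p = Data.Empty.⊥-elim (p Relation.Binary.PropositionalEquality.refl)

data Walk {n : ℕ} (G : Graph n) : Fin n → Fin n → Set where
  []  : ∀ {u} → Walk G u u
  _∷_ : ∀ {u w v} → adj G u w ≡ true → Walk G w v → Walk G u v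

len : ∀ {n} {G : Graph n} {u v} → Walk G u v → ℕ
len []      = 0
len (_ ∷ p) = suc (len p)

vertices : ∀ {n} {G : Graph n} {u v} → Walk G u v → List (Fin n)
vertices {u = u} []      = u ∷ []
vertices {u = u} (_ ∷ p) = u ∷ vertices p

IsPath : ∀ {n} {G : Graph n} {u v} → Walk G u v → Set
IsPath p = Unique (vertices p)

Path : ∀ {n} → Graph n → Fin n → Fin n → Set
Path G u v = Σ (Walk G u v) IsPath

Connected : ∀ {n} → Graph n → Set
Connected G = ∀ u v → Path G u v

DistAtLeast : ∀ {n} → Graph n → Fin n → Fin n → ℕ → Set
DistAtLeast G u v d = ∀ (p : Path G u v) → d ≤ len (Data.Product.proj₁ p)

DiamAtLeast : ∀ {n} → Graph n → ℕ → Set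
DiamAtLeast G d = ∃[ u ] ∃[ v ] DistAtLeast G u v d

-- An edge-colouring with k colours: a colour for each unordered pair
-- (symmetric function); only its values on edges matter.
record EdgeColouring {n : ℕ} (G : Graph n) (k : ℕ) : Set where
  field
    col  : Fin n → Fin n → Fin k
    csym : ∀ u v → col u v ≡ col v u
open EdgeColouring public

edgeColours : ∀ {n} {G : Graph n} {k} → EdgeColouring G k → ∀ {u v} → Walk G u v → List (Fin k)
edgeColours c []              = []
edgeColours c (_∷_ {u} {w} _ p) = col c u w ∷ edgeColours c p

Rainbow : ∀ {n} {G : Graph n} {k} → EdgeColouring G k → ∀ {u v} → Walk G u v → Set
Rainbow c p = Unique (edgeColours c p)

RainbowConnected : ∀ {n} {G : Graph n} {k} → EdgeColouring G k → Set
RainbowConnected {G = G} c = ∀ u v → ∃[ p ] (IsPath {G = G} {u} {v} p × Rainbow c p)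

RcAtMost : ∀ {n} → Graph n → ℕ → Set
RcAtMost G k = Σ (EdgeColouring G k) RainbowConnected

-- Fix x, y at distance at least 4 in the complement and split V into {x},
-- {y}, A (the other non-neighbours of x), B (neighbours of x not adjacent to
-- y) and C (common neighbours of x and y). Excluding short complement paths
-- from x to y, G contains xy and all edges between y and A and between A and
-- B; A and B are nonempty because the complement is connected. Colouring
-- xy ↦ 1, yA ↦ 0, xB ↦ 2, AB ↦ 3, xC ↦ 0, yC ↦ 2, any two vertices are joined
-- by a rainbow path of length at most 4 through x, y and fixed a ∈ A, b ∈ B
-- (e.g. u y x b v for u, v ∈ A).
module Submission where

open import Defs renaming (sym to adj-sym)
open import Data.Nat using (ℕ; _<?_)
open import Data.Nat.Properties using (<⇒≱)
open import Data.Fin using (Fin; _≟_)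
open import Data.Fin.Patterns using (0F; 1F; 2F; 3F; 4F)
open import Data.Fin.Properties using (all?)
open import Data.Bool using (true; false; not)
open import Data.Bool.Properties using (¬-not; not-involutive)
open import Data.Product using (∃-syntax; _×_; _,_; proj₁; proj₂)
open import Data.Empty using (⊥; ⊥-elim)
open import Data.List using (List; []; _∷_; _∷ʳ_; map)
open import Data.List.Relation.Unary.All using ([]; _∷_)
open import Data.List.Relation.Unary.All.Properties using (∷ʳ⁺)
open import Data.List.Relation.Unary.AllPairs using ([]; _∷_)
open import Data.List.Relation.Unary.Unique.Propositional using (Unique)
open import Data.List.Relation.Unary.Unique.Propositional.Properties using (map⁻)
import Data.List.Relation.Unary.Unique.DecPropositional as DecUnique
open import Relation.Nullary using (yes; no)
open import Relation.Unary using (Decidable)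
open import Relation.Nullary.Decidable using (True; toWitness)
open import Relation.Binary.PropositionalEquality
  using (_≡_; _≢_; refl; sym; trans; cong; cong₂; subst; ≢-sym)

Unique-∷-∷ʳ : ∀ {A : Set} {x y : A} {xs} →
              x ≢ y → Unique (x ∷ xs) → Unique (xs ∷ʳ y) → Unique (x ∷ xs ∷ʳ y)
Unique-∷-∷ʳ x≢y (x∉xs ∷ _) xs∷ʳy-unique = ∷ʳ⁺ x∉xs x≢y ∷ xs∷ʳy-unique

true≢false : true ≢ false
true≢false ()

first-step : ∀ {n} {H : Graph n} {u v} → u ≢ v → Walk H u v → ∃[ w ] adj H u w ≡ true
first-step u≢v []        = ⊥-elim (u≢v refl)
first-step _   (u~w ∷ _) = _ , u~w

module _ {n : ℕ} (G : Graph n) where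

  adj-flip : ∀ {u v b} → adj G u v ≡ b → adj G v u ≡ b
  adj-flip {u} {v} u~v = trans (adj-sym G v u) u~v

  adjacent⇒distinct : ∀ {u v} → adj G u v ≡ true → u ≢ v
  adjacent⇒distinct {u} u~u refl = true≢false (trans (sym u~u) (irrefl G u))

  co-adjacent : ∀ {u v} → u ≢ v → adj G u v ≡ false → adj (complement G) u v ≡ true
  co-adjacent {u} {v} u≢v u≁v with u ≟ v
  ... | yes u≡v = ⊥-elim (u≢v u≡v)
  ... | no _ rewrite u≁v = refl

  co-adjacent⁻ : ∀ {u v} → adj (complement G) u v ≡ true → u ≢ v × adj G u v ≡ false
  co-adjacent⁻ {u} {v} u~̄v with u ≟ v
  ... | no u≢v = u≢v , trans (sym (not-involutive _)) (cong not u~̄v)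

-- Each fact below holds because its failure would give a path x … y with at
-- most three edges in the complement.
module FarApart {n} (G : Graph n) {x y : Fin n} (far : DistAtLeast (complement G) x y 4) where

  no-short-path : (p : Walk (complement G) x y) → IsPath p → {True (len p <? 4)} → ⊥
  no-short-path p p-path {short} = <⇒≱ (toWitness short) (far (p , p-path))

  x≢y : x ≢ y
  x≢y refl = no-short-path [] ([] ∷ [])

  x~y : adj G x y ≡ true
  x~y = ¬-not λ x≁y → no-short-path (co-adjacent G x≢y x≁y ∷ []) ((x≢y ∷ []) ∷ [] ∷ [])

  y~a : ∀ {a} → a ≢ x → a ≢ y → adj G x a ≡ false → adj G y a ≡ true
  y~a {a} a≢x a≢y x≁a = ¬-not λ y≁a →
    no-short-path (co-adjacent G x≢a x≁a ∷ co-adjacent G a≢y (adj-flip G y≁a) ∷ [])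
                  ((x≢a ∷ x≢y ∷ []) ∷ (a≢y ∷ []) ∷ [] ∷ [])
    where x≢a = ≢-sym a≢x

  a~b : ∀ {a b} → a ≢ x → a ≢ y → adj G x a ≡ false →
        b ≢ y → adj G x b ≡ true → adj G y b ≡ false → adj G a b ≡ true
  a~b {a} {b} a≢x a≢y x≁a b≢y x~b y≁b = ¬-not λ a≁b →
    no-short-path (co-adjacent G x≢a x≁a ∷ co-adjacent G a≢b a≁b ∷
                   co-adjacent G b≢y (adj-flip G y≁b) ∷ [])
                  ((x≢a ∷ x≢b ∷ x≢y ∷ []) ∷ (a≢b ∷ a≢y ∷ []) ∷ (b≢y ∷ []) ∷ [] ∷ [])
    where
    x≢a = ≢-sym a≢x
    x≢b = adjacent⇒distinct G x~b
    a≢b : a ≢ b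
    a≢b refl = true≢false (trans (sym x~b) x≁a)

module ClassColouring {n k} (G : Graph n) {K : Set} (class : Fin n → K)
  (κ : K → K → Fin k) (κ-sym : ∀ s t → κ s t ≡ κ t s) (_⇿_ : K → K → Set)
  (join : ∀ {s t u v} → s ⇿ t → class u ≡ s → class v ≡ t → adj G u v ≡ true) where

  colouring : EdgeColouring G k
  colouring = record { col = λ u v → κ (class u) (class v) ; csym = λ u v → κ-sym (class u) (class v) }

  RainbowPath : Fin n → Fin n → Set
  RainbowPath u v = ∃[ p ] (IsPath {G = G} {u} {v} p × Rainbow colouring p)

  colours : K → List K → List (Fin k)
  colours s []       = []
  colours s (t ∷ ts) = κ s t ∷ colours t ts

  infixr 5 _∷_
  infix 6 _─_

  -- The classes along the route are s, then ms, then t.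
  data Route : K → List K → K → Fin n → Fin n → Set where
    _─_ : ∀ {s t u v} → class u ≡ s → class v ≡ t → ⦃ s ⇿ t ⦄ → Route s [] t u v
    _∷_ : ∀ {s m ms t u w v} → class u ≡ s → Route m ms t w v → ⦃ s ⇿ m ⦄ →
          Route s (m ∷ ms) t u v

  private variable
    s t : K
    ms : List K
    u v : Fin n

  first-class : Route s ms t u v → class u ≡ s
  first-class (cu ─ _) = cu
  first-class (cu ∷ _) = cu

  walk : Route s ms t u v → Walk G u v
  walk (_─_ cu cv ⦃ e ⦄) = join e cu cv ∷ []
  walk (_∷_ cu r ⦃ e ⦄)  = join e cu (first-class r) ∷ walk r

  inner : Route s ms t u v → List (Fin n)
  inner (_ ─ _)          = []
  inner (_∷_ {w = w} _ r) = w ∷ inner r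

  vertices-walk : (r : Route s ms t u v) → vertices (walk r) ≡ u ∷ inner r ∷ʳ v
  vertices-walk (_ ─ _) = refl
  vertices-walk (_ ∷ r) = cong (_ ∷_) (vertices-walk r)

  classes-init : (r : Route s ms t u v) → map class (u ∷ inner r) ≡ s ∷ ms
  classes-init (cu ─ _) = cong (_∷ []) cu
  classes-init (cu ∷ r) = cong₂ _∷_ cu (classes-init r)

  classes-tail : (r : Route s ms t u v) → map class (inner r ∷ʳ v) ≡ ms ∷ʳ t
  classes-tail (_ ─ cv) = cong (_∷ []) cv
  classes-tail (_ ∷ r)  = cong₂ _∷_ (first-class r) (classes-tail r)

  edgeColours-walk : (r : Route s ms t u v) → edgeColours colouring (walk r) ≡ colours s (ms ∷ʳ t)
  edgeColours-walk (cu ─ cv) = cong (_∷ []) (cong₂ κ cu cv)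
  edgeColours-walk (cu ∷ r)  = cong₂ _∷_ (cong₂ κ cu (first-class r)) (edgeColours-walk r)

  route⇒rainbowPath : ∀ {s ms t u v} (r : Route s ms t u v) → u ≢ v →
                      Unique (s ∷ ms) → Unique (ms ∷ʳ t) → Unique (colours s (ms ∷ʳ t)) →
                      RainbowPath u v
  route⇒rainbowPath {u = u} {v} r u≢v s∷ms-unique ms∷ʳt-unique colours-unique =
    walk r ,
    subst Unique (sym (vertices-walk r)) (Unique-∷-∷ʳ u≢v u∷inner-unique inner∷ʳv-unique) ,
    subst Unique (sym (edgeColours-walk r)) colours-unique
    where
    u∷inner-unique : Unique (u ∷ inner r)
    u∷inner-unique = map⁻ (subst Unique (sym (classes-init r)) s∷ms-unique)
    inner∷ʳv-unique : Unique (inner r ∷ʳ v)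
    inner∷ʳv-unique = map⁻ (subst Unique (sym (classes-tail r)) ms∷ʳt-unique)

-- Classes live in Fin 5 so that uniqueness of a list of classes is decidable.
Class : Set
Class = Fin 5

pattern X = 0F
pattern Y = 1F
pattern A = 2F
pattern B = 3F
pattern C = 4F

data _⇿_ : Class → Class → Set where
  instance
    XY : X ⇿ Y
    YX : Y ⇿ X
    YA : Y ⇿ A
    AY : A ⇿ Y
    XB : X ⇿ B
    BX : B ⇿ X
    XC : X ⇿ C
    CX : C ⇿ X
    YC : Y ⇿ C
    CY : C ⇿ Y
    AB : A ⇿ B
    BA : B ⇿ A

κ : Class → Class → Fin 4
κ X Y = 1F
κ Y X = 1F
κ Y A = 0F
κ A Y = 0F
κ X B = 2F
κ B X = 2F
κ A B = 3F
κ B A = 3F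
κ X C = 0F
κ C X = 0F
κ Y C = 2F
κ C Y = 2F
κ _ _ = 0F

κ-sym : ∀ s t → κ s t ≡ κ t s
κ-sym = toWitness {a? = all? λ s → all? λ t → κ s t ≟ κ t s} _

module Partition {n} (G : Graph n) {x y : Fin n} (far : DistAtLeast (complement G) x y 4)
                 (co-connected : Connected (complement G)) where
  open FarApart G far

  data _∈_ (u : Fin n) : Class → Set where
    ∈X : u ≡ x → u ∈ X
    ∈Y : u ≡ y → u ∈ Y
    ∈A : u ≢ x → u ≢ y → adj G x u ≡ false → u ∈ A
    ∈B : u ≢ y → adj G x u ≡ true → adj G y u ≡ false → u ∈ B
    ∈C : adj G x u ≡ true → adj G y u ≡ true → u ∈ C

  class : Fin n → Class
  class u with u ≟ x | u ≟ y | adj G x u | adj G y u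
  ... | yes _ | _     | _     | _     = X
  ... | no _  | yes _ | _     | _     = Y
  ... | no _  | no _  | false | _     = A
  ... | no _  | no _  | true  | false = B
  ... | no _  | no _  | true  | true  = C

  class⇒∈ : ∀ {u s} → class u ≡ s → u ∈ s
  class⇒∈ {u} refl with u ≟ x | u ≟ y | adj G x u in xu | adj G y u in yu
  ... | yes u≡x | _       | _     | _     = ∈X u≡x
  ... | no _    | yes u≡y | _     | _     = ∈Y u≡y
  ... | no u≢x  | no u≢y  | false | _     = ∈A u≢x u≢y xu
  ... | no _    | no u≢y  | true  | false = ∈B u≢y xu yu
  ... | no _    | no _    | true  | true  = ∈C xu yu

  class-x : class x ≡ X
  class-x with x ≟ x
  ... | yes _  = refl
  ... | no x≢x = ⊥-elim (x≢x refl)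

  class-y : class y ≡ Y
  class-y with y ≟ x | y ≟ y
  ... | yes y≡x | _      = ⊥-elim (x≢y (sym y≡x))
  ... | no _    | yes _  = refl
  ... | no _    | no y≢y = ⊥-elim (y≢y refl)

  class-A : ∀ {u} → u ≢ x → u ≢ y → adj G x u ≡ false → class u ≡ A
  class-A {u} u≢x u≢y x≁u with u ≟ x | u ≟ y
  ... | yes u≡x | _       = ⊥-elim (u≢x u≡x)
  ... | no _    | yes u≡y = ⊥-elim (u≢y u≡y)
  ... | no _    | no _    rewrite x≁u = refl

  class-B : ∀ {u} → u ≢ x → u ≢ y → adj G x u ≡ true → adj G y u ≡ false → class u ≡ B
  class-B {u} u≢x u≢y x~u y≁u with u ≟ x | u ≟ y
  ... | yes u≡x | _       = ⊥-elim (u≢x u≡x)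
  ... | no _    | yes u≡y = ⊥-elim (u≢y u≡y)
  ... | no _    | no _    rewrite x~u | y≁u = refl

  members-adjacent : ∀ {s t u v} → s ⇿ t → u ∈ s → v ∈ t → adj G u v ≡ true
  members-adjacent XY (∈X refl) (∈Y refl)        = x~y
  members-adjacent YX (∈Y refl) (∈X refl)        = adj-flip G x~y
  members-adjacent YA (∈Y refl) (∈A v≢x v≢y x≁v) = y~a v≢x v≢y x≁v
  members-adjacent AY (∈A u≢x u≢y x≁u) (∈Y refl) = adj-flip G (y~a u≢x u≢y x≁u)
  members-adjacent XB (∈X refl) (∈B _ x~v _)     = x~v
  members-adjacent BX (∈B _ x~u _) (∈X refl)     = adj-flip G x~u
  members-adjacent XC (∈X refl) (∈C x~v _)       = x~v
  members-adjacent CX (∈C x~u _) (∈X refl)       = adj-flip G x~u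
  members-adjacent YC (∈Y refl) (∈C _ y~v)       = y~v
  members-adjacent CY (∈C _ y~u) (∈Y refl)       = adj-flip G y~u
  members-adjacent AB (∈A u≢x u≢y x≁u) (∈B v≢y x~v y≁v) = a~b u≢x u≢y x≁u v≢y x~v y≁v
  members-adjacent BA (∈B u≢y x~u y≁u) (∈A v≢x v≢y x≁v) = adj-flip G (a~b v≢x v≢y x≁v u≢y x~u y≁u)

  open ClassColouring G class κ κ-sym _⇿_
         (λ s⇿t cu cv → members-adjacent s⇿t (class⇒∈ cu) (class⇒∈ cv)) public

  A-inhabited : ∃[ a ] class a ≡ A
  A-inhabited with first-step x≢y (proj₁ (co-connected x y))
  ... | a , x~̄a with co-adjacent⁻ G x~̄a
  ... | x≢a , x≁a = a , class-A (≢-sym x≢a) a≢y x≁a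
    where
    a≢y : a ≢ y
    a≢y refl = true≢false (trans (sym x~y) x≁a)

  B-inhabited : ∃[ b ] class b ≡ B
  B-inhabited with first-step (≢-sym x≢y) (proj₁ (co-connected y x))
  ... | b , y~̄b with co-adjacent⁻ G y~̄b
  ... | y≢b , y≁b = b , class-B b≢x (≢-sym y≢b) x~b y≁b
    where
    b≢x : b ≢ x
    b≢x refl = true≢false (trans (sym (adj-flip G x~y)) y≁b)
    x~b : adj G x b ≡ true
    x~b = ¬-not λ x≁b → true≢false (trans (sym (y~a b≢x (≢-sym y≢b) x≁b)) y≁b)

  class-a : class (proj₁ A-inhabited) ≡ A
  class-a = proj₂ A-inhabited

  class-b : class (proj₁ B-inhabited) ≡ B
  class-b = proj₂ B-inhabited

  X-is-x : ∀ {u} → class u ≡ X → u ≡ x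
  X-is-x cu with class⇒∈ cu
  ... | ∈X u≡x = u≡x

  Y-is-y : ∀ {u} → class u ≡ Y → u ≡ y
  Y-is-y cu with class⇒∈ cu
  ... | ∈Y u≡y = u≡y

  unique? : ∀ {m} → Decidable (Unique {A = Fin m})
  unique? = DecUnique.unique? _≟_

  -- For a concrete route the side conditions are closed decidable statements,
  -- so the implicit arguments are solved by computation.
  via : ∀ {s ms t u v} (r : Route s ms t u v) → u ≢ v →
        {_ : True (unique? (s ∷ ms))} {_ : True (unique? (ms ∷ʳ t))}
        {_ : True (unique? (colours s (ms ∷ʳ t)))} → RainbowPath u v
  via r u≢v {p} {q} {c} = route⇒rainbowPath r u≢v (toWitness p) (toWitness q) (toWitness c)

  rainbowPath : ∀ {u v} → u ≢ v → RainbowPath u v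
  rainbowPath {u} {v} u≢v with class u in cu | class v in cv
  ... | X | X = ⊥-elim (u≢v (trans (X-is-x cu) (sym (X-is-x cv))))
  ... | X | Y = via (cu ─ cv) u≢v
  ... | X | A = via (cu ∷ class-y ─ cv) u≢v
  ... | X | B = via (cu ─ cv) u≢v
  ... | X | C = via (cu ─ cv) u≢v
  ... | Y | X = via (cu ─ cv) u≢v
  ... | Y | Y = ⊥-elim (u≢v (trans (Y-is-y cu) (sym (Y-is-y cv))))
  ... | Y | A = via (cu ─ cv) u≢v
  ... | Y | B = via (cu ∷ class-x ─ cv) u≢v
  ... | Y | C = via (cu ─ cv) u≢v
  ... | A | X = via (cu ∷ class-y ─ cv) u≢v
  ... | A | Y = via (cu ─ cv) u≢v
  ... | A | A = via (cu ∷ class-y ∷ class-x ∷ class-b ─ cv) u≢v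
  ... | A | B = via (cu ─ cv) u≢v
  ... | A | C = via (cu ∷ class-y ─ cv) u≢v
  ... | B | X = via (cu ─ cv) u≢v
  ... | B | Y = via (cu ∷ class-x ─ cv) u≢v
  ... | B | A = via (cu ─ cv) u≢v
  ... | B | B = via (cu ∷ class-x ∷ class-y ∷ class-a ─ cv) u≢v
  ... | B | C = via (cu ∷ class-x ─ cv) u≢v
  ... | C | X = via (cu ─ cv) u≢v
  ... | C | Y = via (cu ─ cv) u≢v
  ... | C | A = via (cu ∷ class-y ─ cv) u≢v
  ... | C | B = via (cu ∷ class-x ─ cv) u≢v
  ... | C | C = via (cu ∷ class-x ∷ class-y ─ cv) u≢v

  rainbowConnected : RainbowConnected colouring
  rainbowConnected u v with u ≟ v
  ... | yes refl = [] , [] ∷ [] , []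
  ... | no u≢v   = rainbowPath u≢v

theorem3p3 : ∀ {n : ℕ} (G : Graph n) → Connected G → Connected (complement G) →
             DiamAtLeast (complement G) 4 → RcAtMost G 4
theorem3p3 G _ co-connected (x , y , far) = colouring , rainbowConnected
  where open Partition G far co-connected
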